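{- Let $w$ be a nonempty pattern over a finite alphabet $\mathcal{A}$, with position lattice $(\mathcal{L},(T_s)_{s},(S_s)_{s})$. Let $s\in\mathcal{L}$ with $|s|>1$, let $i\in\{0,\dots,|w|-1\}\setminus s$ and $x\in\mathcal{A}$. If $x\neq w_i$ then $T_{s\setminus\{\max s\}}(i,x)\prec s$.
   Context: Words are indexed from $0$. For $I\subseteq\mathbb{N}$ and $k\in\mathbb{N}$, $I\ominus k=\{i-k: i\in I,\ i\ge k\}$. The position lattice of $w$ consists of: the set $\mathcal{L}$ of all subsets of $\{0,\dots,|w|-1\}$ other than $\{0,\dots,|w|-1\}$ itself; and, for each $s\in\mathcal{L}$, maps $S_s,T_s$ defined on $(\{0,\dots,|w|-1\}\setminus s)\times\mathcal{A}$ by: $S_s(i,x)$ is the least integer $k$, with $k\ge1$ if $|s|=|w|-1$ and $k\ge0$ otherwise, such that ($w_{i-k}=x$ whenever $i\ge k$) and $w_j=w_{j+k}$ for all $j\in s\ominus k$; and $T_s(i,x)=(s\cup\{i\})\ominus S_s(i,x)$. The total order $\preccurlyeq$ on $\mathcal{L}$: $s\preccurlyeq s'$ iff $|s|<|s'|$, or $|s|=|s'|$, $s\neq s'$ and $\min(s\triangle s')\in s$ (where $\triangle$ is symmetric difference), or $s=s'$. Write $s\prec s'$ for $s\preccurlyeq s'$ and $s\neq s'$. -}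

module Defs where

open import Data.Nat using (ℕ; zero; suc; _+_; _∸_; _≤_; _<_)
open import Data.Fin using (Fin; toℕ)
import Data.Fin as F
open import Data.Fin.Subset using (Subset; _∈_; _∉_; _∪_; ⁅_⁆; ∣_∣; _-_; ⊤)
open import Data.Bool using (Bool; true; false)
open import Data.Vec using (Vec; []; _∷_; tabulate)
open import Data.Product using (_×_; ∃-syntax)
open import Data.Sum using (_⊎_)
open import Function.Bundles using (_⇔_)
open import Relation.Binary.PropositionalEquality using (_≡_)

Word : ℕ → ℕ → Set
Word q n = Fin n → Fin q

memℕ : ∀ {n} → ℕ → Subset n → Bool
memℕ m       []       = false
memℕ zero    (b ∷ _)  = b
memℕ (suc m) (_ ∷ bs) = memℕ m bs

_⊖_ : ∀ {n} → Subset n → ℕ → Subset n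
I ⊖ k = tabulate (λ j → memℕ (toℕ j + k) I)

-- The condition on k in the definition of S_s(i,x) (without the lower bound):
-- (w_{i-k} = x whenever i ≥ k) and (w_j = w_{j+k} for all j ∈ s ⊖ k).
SCond : ∀ {q n} → Word q n → Subset n → Fin n → Fin q → ℕ → Set
SCond {n = n} w s i x k =
  ((j : Fin n) → toℕ j + k ≡ toℕ i → w j ≡ x)
  × ((j j' : Fin n) → toℕ j' ≡ toℕ j + k → j' ∈ s → w j ≡ w j')

SLow : ∀ {n} → Subset n → ℕ → Set
SLow {n} s k = ∣ s ∣ ≡ n ∸ 1 → 1 ≤ k

IsS : ∀ {q n} → Word q n → Subset n → Fin n → Fin q → ℕ → Set
IsS w s i x k =
  SLow s k × SCond w s i x k × (∀ k' → SLow s k' → SCond w s i x k' → k ≤ k')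

Tmap : ∀ {n} → Subset n → Fin n → ℕ → Subset n
Tmap s i k = (s ∪ ⁅ i ⁆) ⊖ k

IsMax : ∀ {n} → Fin n → Subset n → Set
IsMax {n} m s = m ∈ s × ((j : Fin n) → j ∈ s → j F.≤ m)

-- strict total order s ≺ s': |s| < |s'|, or |s| = |s'|, s ≠ s' and
-- min(s △ s') ∈ s  (unfolded: some m ∈ s, m ∉ s', and s, s' agree below m).
_≺_ : ∀ {n} → Subset n → Subset n → Set
_≺_ {n} s s' =
  ∣ s ∣ < ∣ s' ∣
  ⊎ (∣ s ∣ ≡ ∣ s' ∣
     × ∃[ m ] (m ∈ s × m ∉ s' × ((j : Fin n) → j F.< m → (j ∈ s ⇔ j ∈ s'))))

module Submission where

-- k ≥ 1, since k = 0 would force w_i = x. The set U = (s ∖ {max s}) ∪ {i} has at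
-- most |s| elements and contains a = min s. If k > a, then a is shifted out and
-- |U ⊖ k| < |s|; otherwise a − k ∈ U ⊖ k lies below every element of s, so either
-- |U ⊖ k| < |s| or min (U ⊖ k) ∉ s and the two sets are empty below it.

open import Defs
open import Data.Nat using (ℕ; suc; _<_)
open import Data.Fin using (Fin)
open import Data.Fin.Subset using (Subset; _∉_; ∣_∣; _-_; ⊤)
open import Relation.Binary.PropositionalEquality using (_≢_)

open import Data.Bool using (Bool; true; false)
open import Data.Fin using (toℕ; fromℕ<; inject)
import Data.Fin as F
import Data.Fin.Properties as FP
open import Data.Fin.Subset using (_∈_; _∪_; ⁅_⁆; _⊆_; Nonempty)
open import Data.Fin.Subset.Properties
  using (_∈?_; p⊆q⇒∣p∣≤∣q∣; ∣p∣≤∣x∷p∣; ∣⁅x⁆∣≡1; ∣⊥∣≡0; Empty-unique; nonempty?;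
         x∈p∪q⁺; x∈⁅x⁆; x∈p∧x≢y⇒x∈p-y; x∈p⇒∣p-x∣<∣p∣; p─q⊆p)
open import Data.Nat using (zero; _+_; _∸_; _≤_; z≤n; s≤s)
open import Data.Nat.Properties
open import Data.Product using (∃; _×_; _,_)
open import Data.Sum using (inj₁; inj₂)
open import Data.Vec using (Vec; []; _∷_; _∷ʳ_; here; there)
open import Data.Vec.Properties using (lookup∘tabulate; []=⇒lookup; lookup⇒[]=)
open import Function.Bundles using (_⇔_; mk⇔)
open import Relation.Nullary using (yes; no; ¬?; contradiction)
open import Relation.Nullary.Decidable using (decidable-stable)
open import Relation.Binary.PropositionalEquality
  using (_≡_; refl; sym; trans; cong; subst; module ≡-Reasoning)

memℕ⇒∈ : ∀ {n} (j : Fin n) (p : Subset n) → memℕ (toℕ j) p ≡ true → j ∈ p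
memℕ⇒∈ F.zero    (true ∷ p) _ = here
memℕ⇒∈ (F.suc j) (_ ∷ p)    h = there (memℕ⇒∈ j p h)

∈⇒memℕ : ∀ {n} {j : Fin n} {p : Subset n} → j ∈ p → memℕ (toℕ j) p ≡ true
∈⇒memℕ {j = F.zero}  {true ∷ p} _         = refl
∈⇒memℕ {j = F.suc j} {_ ∷ p}    (there h) = ∈⇒memℕ h

∈-⊖⁺ : ∀ {n} (j : Fin n) (I : Subset n) k → memℕ (toℕ j + k) I ≡ true → j ∈ I ⊖ k
∈-⊖⁺ j I k h = lookup⇒[]= j _ (trans (lookup∘tabulate (λ j → memℕ (toℕ j + k) I) j) h)

∈-⊖⁻ : ∀ {n} {j : Fin n} (I : Subset n) k → j ∈ I ⊖ k → memℕ (toℕ j + k) I ≡ true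
∈-⊖⁻ {j = j} I k j∈ = trans (sym (lookup∘tabulate (λ j → memℕ (toℕ j + k) I) j)) ([]=⇒lookup j∈)

memℕ-∷ʳfalse : ∀ {n} (v : Vec Bool n) m → memℕ m (v ∷ʳ false) ≡ memℕ m v
memℕ-∷ʳfalse []      zero    = refl
memℕ-∷ʳfalse []      (suc m) = refl
memℕ-∷ʳfalse (b ∷ v) zero    = refl
memℕ-∷ʳfalse (b ∷ v) (suc m) = memℕ-∷ʳfalse v m

∣∷ʳfalse∣ : ∀ {n} (v : Subset n) → ∣ v ∷ʳ false ∣ ≡ ∣ v ∣
∣∷ʳfalse∣ []          = refl
∣∷ʳfalse∣ (true ∷ v)  = cong suc (∣∷ʳfalse∣ v)
∣∷ʳfalse∣ (false ∷ v) = ∣∷ʳfalse∣ v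

shiftDown : ∀ {n} → Subset n → Subset n
shiftDown []      = []
shiftDown (_ ∷ p) = p ∷ʳ false

memℕ-shiftDown : ∀ {n} (p : Subset n) m → memℕ m (shiftDown p) ≡ memℕ (suc m) p
memℕ-shiftDown []      m = refl
memℕ-shiftDown (_ ∷ p) m = memℕ-∷ʳfalse p m

∣shiftDown∣≤ : ∀ {n} (p : Subset n) → ∣ shiftDown p ∣ ≤ ∣ p ∣
∣shiftDown∣≤ []      = ≤-refl
∣shiftDown∣≤ (b ∷ p) = subst (_≤ ∣ b ∷ p ∣) (sym (∣∷ʳfalse∣ p)) (∣p∣≤∣x∷p∣ b p)

⊖-zero-⊆ : ∀ {n} (I : Subset n) → I ⊖ 0 ⊆ I
⊖-zero-⊆ I {j} j∈ = memℕ⇒∈ j I (subst (λ a → memℕ a I ≡ true) (+-identityʳ (toℕ j)) (∈-⊖⁻ I 0 j∈))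

⊖-suc-⊆ : ∀ {n} (I : Subset n) k → I ⊖ suc k ⊆ shiftDown I ⊖ k
⊖-suc-⊆ I k {j} j∈ = ∈-⊖⁺ j (shiftDown I) k (begin
  memℕ (toℕ j + k) (shiftDown I)  ≡⟨ memℕ-shiftDown I (toℕ j + k) ⟩
  memℕ (suc (toℕ j + k)) I        ≡⟨ cong (λ a → memℕ a I) (sym (+-suc (toℕ j) k)) ⟩
  memℕ (toℕ j + suc k) I          ≡⟨ ∈-⊖⁻ I (suc k) j∈ ⟩
  true                            ∎)
  where open ≡-Reasoning

∣⊖∣≤ : ∀ {n} (I : Subset n) k → ∣ I ⊖ k ∣ ≤ ∣ I ∣
∣⊖∣≤ I zero    = p⊆q⇒∣p∣≤∣q∣ (⊖-zero-⊆ I)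
∣⊖∣≤ I (suc k) = begin
  ∣ I ⊖ suc k ∣         ≤⟨ p⊆q⇒∣p∣≤∣q∣ (⊖-suc-⊆ I k) ⟩
  ∣ shiftDown I ⊖ k ∣   ≤⟨ ∣⊖∣≤ (shiftDown I) k ⟩
  ∣ shiftDown I ∣       ≤⟨ ∣shiftDown∣≤ I ⟩
  ∣ I ∣                 ∎
  where open ≤-Reasoning

∣⊖∣< : ∀ {n} (I : Subset n) {a} k → memℕ a I ≡ true → a < k → ∣ I ⊖ k ∣ < ∣ I ∣
∣⊖∣< (true ∷ p) {zero} (suc k) _ _ = begin-strict
  ∣ (true ∷ p) ⊖ suc k ∣       ≤⟨ p⊆q⇒∣p∣≤∣q∣ (⊖-suc-⊆ (true ∷ p) k) ⟩
  ∣ (p ∷ʳ false) ⊖ k ∣         ≤⟨ ∣⊖∣≤ (p ∷ʳ false) k ⟩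
  ∣ p ∷ʳ false ∣               ≡⟨ ∣∷ʳfalse∣ p ⟩
  ∣ p ∣                        <⟨ n<1+n ∣ p ∣ ⟩
  ∣ true ∷ p ∣                 ∎
  where open ≤-Reasoning
∣⊖∣< I {suc a} (suc k) a∈I (s≤s a<k) = begin-strict
  ∣ I ⊖ suc k ∣         ≤⟨ p⊆q⇒∣p∣≤∣q∣ (⊖-suc-⊆ I k) ⟩
  ∣ shiftDown I ⊖ k ∣   <⟨ ∣⊖∣< (shiftDown I) k (trans (memℕ-shiftDown I a) a∈I) a<k ⟩
  ∣ shiftDown I ∣       ≤⟨ ∣shiftDown∣≤ I ⟩
  ∣ I ∣                 ∎
  where open ≤-Reasoning

∣p∪q∣≤∣p∣+∣q∣ : ∀ {n} (p q : Subset n) → ∣ p ∪ q ∣ ≤ ∣ p ∣ + ∣ q ∣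
∣p∪q∣≤∣p∣+∣q∣ []          []          = z≤n
∣p∪q∣≤∣p∣+∣q∣ (true ∷ p)  (b ∷ q)     = s≤s (≤-trans (∣p∪q∣≤∣p∣+∣q∣ p q) (+-monoʳ-≤ ∣ p ∣ (∣p∣≤∣x∷p∣ b q)))
∣p∪q∣≤∣p∣+∣q∣ (false ∷ p) (true ∷ q)  = ≤-trans (s≤s (∣p∪q∣≤∣p∣+∣q∣ p q)) (≤-reflexive (sym (+-suc ∣ p ∣ ∣ q ∣)))
∣p∪q∣≤∣p∣+∣q∣ (false ∷ p) (false ∷ q) = ∣p∪q∣≤∣p∣+∣q∣ p q

∣p∪⁅x⁆∣≤1+∣p∣ : ∀ {n} (p : Subset n) x → ∣ p ∪ ⁅ x ⁆ ∣ ≤ suc ∣ p ∣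
∣p∪⁅x⁆∣≤1+∣p∣ p x = begin
  ∣ p ∪ ⁅ x ⁆ ∣      ≤⟨ ∣p∪q∣≤∣p∣+∣q∣ p ⁅ x ⁆ ⟩
  ∣ p ∣ + ∣ ⁅ x ⁆ ∣  ≡⟨ cong (∣ p ∣ +_) (∣⁅x⁆∣≡1 x) ⟩
  ∣ p ∣ + 1          ≡⟨ +-comm ∣ p ∣ 1 ⟩
  suc ∣ p ∣          ∎
  where open ≤-Reasoning

∣p∣≤1+∣p-x∣ : ∀ {n} (p : Subset n) x → ∣ p ∣ ≤ suc ∣ p - x ∣
∣p∣≤1+∣p-x∣ p x = ≤-trans (p⊆q⇒∣p∣≤∣q∣ p⊆p-x∪⁅x⁆) (∣p∪⁅x⁆∣≤1+∣p∣ (p - x) x)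
  where
  p⊆p-x∪⁅x⁆ : p ⊆ (p - x) ∪ ⁅ x ⁆
  p⊆p-x∪⁅x⁆ {y} y∈p with y FP.≟ x
  ... | yes refl = x∈p∪q⁺ (inj₂ (x∈⁅x⁆ y))
  ... | no y≢x   = x∈p∪q⁺ (inj₁ (x∈p∧x≢y⇒x∈p-y y∈p y≢x))

∣p-x∪⁅y⁆∣≤∣p∣ : ∀ {n} {p : Subset n} {x} y → x ∈ p → ∣ (p - x) ∪ ⁅ y ⁆ ∣ ≤ ∣ p ∣
∣p-x∪⁅y⁆∣≤∣p∣ {p = p} {x} y x∈p = ≤-trans (∣p∪⁅x⁆∣≤1+∣p∣ (p - x) y) (x∈p⇒∣p-x∣<∣p∣ x∈p)

∣p∣>0⇒Nonempty : ∀ {n} (p : Subset n) → 0 < ∣ p ∣ → Nonempty p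
∣p∣>0⇒Nonempty {n} p 0<∣p∣ with nonempty? p
... | yes ne = ne
... | no  e  = contradiction (trans (cong ∣_∣ (Empty-unique e)) (∣⊥∣≡0 n)) (>⇒≢ 0<∣p∣)

IsMin : ∀ {n} → Fin n → Subset n → Set
IsMin {n} t p = t ∈ p × ((j : Fin n) → j ∈ p → t F.≤ j)

least-∈ : ∀ {n} {p : Subset n} → Nonempty p → ∃ λ t → IsMin t p
least-∈ {n} {p} (j , j∈p) with FP.¬∀⟶∃¬-smallest n (_∉ p) (λ u → ¬? (u ∈? p)) (λ ∀∉ → ∀∉ j j∈p)
... | t , ¬t∉p , below = t , decidable-stable (t ∈? p) ¬t∉p , t≤
  where
  t≤ : (u : Fin n) → u ∈ p → t F.≤ u
  t≤ u u∈p = ≮⇒≥ λ u<t → below (fromℕ< u<t) (subst (_∈ p) (sym (inject-fromℕ< u<t)) u∈p)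
    where
    inject-fromℕ< : (u<t : u F.< t) → inject {i = t} (fromℕ< u<t) ≡ u
    inject-fromℕ< u<t = FP.toℕ-injective (trans (FP.toℕ-inject (fromℕ< u<t)) (FP.toℕ-fromℕ< u<t))

IsMin[p-max]⇒IsMin : ∀ {n} {s : Subset n} {a m} → IsMax m s → IsMin a (s - m) → IsMin a s
IsMin[p-max]⇒IsMin {s = s} {a} {m} (m∈s , ≤m) (a∈s-m , a≤) = a∈s , a≤s
  where
  a∈s : a ∈ s
  a∈s = p─q⊆p s ⁅ m ⁆ a∈s-m
  a≤s : ∀ j → j ∈ s → a F.≤ j
  a≤s j j∈s with j FP.≟ m
  ... | yes refl = ≤m a a∈s
  ... | no j≢m   = a≤ j (x∈p∧x≢y⇒x∈p-y j∈s j≢m)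

≺-if-below-min : ∀ {n} {T s : Subset n} {t} → ∣ T ∣ ≤ ∣ s ∣ → t ∈ T → (∀ j → j ∈ s → t F.< j) → T ≺ s
≺-if-below-min {T = T} {s} {t} ∣T∣≤∣s∣ t∈T t<s with m≤n⇒m<n∨m≡n ∣T∣≤∣s∣
... | inj₁ ∣T∣<∣s∣ = inj₁ ∣T∣<∣s∣
... | inj₂ ∣T∣≡∣s∣ with least-∈ (t , t∈T)
...   | t₀ , t₀∈T , t₀≤ = inj₂ (∣T∣≡∣s∣ , t₀ , t₀∈T , t₀∉s , agree)
  where
  t₀∉s : t₀ ∉ s
  t₀∉s t₀∈s = <⇒≱ (t<s t₀ t₀∈s) (t₀≤ t t∈T)
  agree : ∀ j → j F.< t₀ → (j ∈ T ⇔ j ∈ s)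
  agree j j<t₀ = mk⇔
    (λ j∈T → contradiction (t₀≤ j j∈T) (<⇒≱ j<t₀))
    (λ j∈s → contradiction (<-≤-trans (<-trans (t<s j j∈s) j<t₀) (t₀≤ t t∈T)) (<-irrefl refl))

⊖-≺ : ∀ {n} {U s : Subset n} {a} k → 0 < k → ∣ U ∣ ≤ ∣ s ∣ → a ∈ U → IsMin a s → (U ⊖ k) ≺ s
⊖-≺ {n} {U} {s} {a} k 0<k ∣U∣≤∣s∣ a∈U (_ , a≤) with k ≤? toℕ a
... | no k≰a = inj₁ (<-≤-trans (∣⊖∣< U k (∈⇒memℕ a∈U) (≰⇒> k≰a)) ∣U∣≤∣s∣)
... | yes k≤a = ≺-if-below-min (≤-trans (∣⊖∣≤ U k) ∣U∣≤∣s∣) t∈U⊖k t<s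
  where
  t : Fin n
  t = fromℕ< (≤-<-trans (m∸n≤m (toℕ a) k) (FP.toℕ<n a))
  t+k≡a : toℕ t + k ≡ toℕ a
  t+k≡a = trans (cong (_+ k) (FP.toℕ-fromℕ< _)) (m∸n+n≡m k≤a)
  t∈U⊖k : t ∈ U ⊖ k
  t∈U⊖k = ∈-⊖⁺ t U k (subst (λ b → memℕ b U ≡ true) (sym t+k≡a) (∈⇒memℕ a∈U))
  t<s : ∀ j → j ∈ s → t F.< j
  t<s j j∈s = begin-strict
    toℕ t      ≡⟨ FP.toℕ-fromℕ< _ ⟩
    toℕ a ∸ k  <⟨ ∸-monoʳ-< 0<k k≤a ⟩
    toℕ a      ≤⟨ a≤ j j∈s ⟩
    toℕ j      ∎
    where open ≤-Reasoning

lemma2 : ∀ {q n} (w : Word q (suc n)) (s : Subset (suc n)) → s ≢ ⊤ → 1 < ∣ s ∣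
    → (i : Fin (suc n)) → i ∉ s → (x : Fin q) → x ≢ w i
    → (m : Fin (suc n)) → IsMax m s
    → (k : ℕ) → IsS w (s - m) i x k
    → Tmap (s - m) i k ≺ s
lemma2 w s _ 1<∣s∣ i _ x x≢wi m max@(m∈s , _) k (_ , (lands-on-x , _) , _)
  with least-∈ (∣p∣>0⇒Nonempty (s - m) (≤-pred (<-≤-trans 1<∣s∣ (∣p∣≤1+∣p-x∣ s m))))
... | a , min[s-m]@(a∈s-m , _) =
  ⊖-≺ k 0<k (∣p-x∪⁅y⁆∣≤∣p∣ i m∈s) (x∈p∪q⁺ (inj₁ a∈s-m)) (IsMin[p-max]⇒IsMin max min[s-m])
  where
  0<k : 0 < k
  0<k = n≢0⇒n>0 λ { refl → x≢wi (sym (lands-on-x i (+-identityʳ (toℕ i)))) }
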